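{- Let $M$ be a set of MDL operators with $\overline{\cdot}\notin M$. Then an arbitrary $\mathrm{MDL}[M]$ formula $\varphi$ is satisfiable if and only if the formula obtained from $\varphi$ by replacing every dependence atom and every atomic proposition with one and the same atomic proposition $t$ is satisfiable.
   Context: Modal dependence logic (MDL). Fix a set $AP$ of atomic propositions. MDL formulas are generated by $\varphi ::= \top \mid \bot \mid p \mid \overline{p} \mid \mathrm{dep}(p_1,\dots,p_{n-1};p_n) \mid \overline{\mathrm{dep}(p_1,\dots,p_{n-1};p_n)} \mid \varphi\wedge\varphi \mid \varphi\vee\varphi \mid \varphi\veebar\varphi \mid \Box\varphi \mid \Diamond\varphi$, where $p,p_i\in AP$ and $n\ge 1$. Here $\overline{\cdot}$ is negation (applied only to atomic propositions and dependence atoms), $\mathrm{dep}(p_1,\dots,p_{n-1};p_n)$ is a dependence atom, $\vee$ is dependence disjunction and $\veebar$ is classical disjunction. A frame is $W=(S,R,\pi)$ with $S$ a nonempty set of worlds, $R\subseteq S\times S$, and $\pi:S\to 2^{AP}$. For $T\subseteq S$, satisfaction $W,T\models\varphi$ is defined by: $W,T\models\top$ always; $W,T\models\bot$ iff $T=\emptyset$; $W,T\models p$ iff $p\in\pi(s)$ for all $s\in T$; $W,T\models\overline{p}$ iff $p\notin\pi(s)$ for all $s\in T$; $W,T\models \mathrm{dep}(p_1,\dots,p_{n-1};p_n)$ iff for all $s_1,s_2\in T$ with $\pi(s_1)\cap\{p_1,\dots,p_{n-1}\}=\pi(s_2)\cap\{p_1,\dots,p_{n-1}\}$ we have $p_n\in\pi(s_1)\Leftrightarrow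 p_n\in\pi(s_2)$; $W,T\models\overline{\mathrm{dep}(\dots)}$ iff $T=\emptyset$; $W,T\models\varphi\wedge\psi$ iff both hold; $W,T\models\varphi\vee\psi$ iff there are $T_1,T_2$ with $T=T_1\cup T_2$, $W,T_1\models\varphi$ and $W,T_2\models\psi$; $W,T\models\varphi\veebar\psi$ iff $W,T\models\varphi$ or $W,T\models\psi$; $W,T\models\Box\varphi$ iff $W,\{s'\mid \exists s\in T,(s,s')\in R\}\models\varphi$; $W,T\models\Diamond\varphi$ iff there is $T'\subseteq S$ with $W,T'\models\varphi$ such that every $s\in T$ has some $s'\in T'$ with $(s,s')\in R$. The MDL operators are $\Box,\Diamond,\wedge,\vee,\overline{\cdot},\top,\bot,\mathrm{dep},\veebar$; for a set $M$ of these, $\mathrm{MDL}[M]$ is the set of MDL formulas built from atomic propositions using only operators and constants from $M$. A formula $\varphi$ is satisfiable if there exist a frame $W$ and a nonempty $T\subseteq S$ with $W,T\models\varphi$. -}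

module Defs where

open import Data.Nat using (ℕ)
open import Data.Bool using (Bool; true; false)
open import Data.List using (List; []; _∷_)
open import Data.List.Relation.Unary.All using (All)
open import Data.Product using (Σ; ∃; _×_; _,_)
open import Data.Sum using (_⊎_)
open import Data.Empty using (⊥)
open import Data.Unit using (⊤)
open import Relation.Nullary using (¬_)
open import Relation.Binary.PropositionalEquality using (_≡_)
open import Level using (Lift; suc; zero)

AP : Set
AP = ℕ

-- MDL formulas.  dep ps q  is  dep(p₁,…,p_{n-1}; p_n) with ps = [p₁,…,p_{n-1}], q = p_n.
data Fml : Set where
  ⊤'    : Fml
  ⊥'    : Fml
  atom  : AP → Fml
  natom : AP → Fml
  dep   : List AP → AP → Fml
  ndep  : List AP → AP → Fml
  _∧'_  : Fml → Fml → Fml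
  _∨'_  : Fml → Fml → Fml
  _⊻'_  : Fml → Fml → Fml
  □_    : Fml → Fml
  ◇_    : Fml → Fml

data Op : Set where
  op□ op◇ op∧ op∨ opNeg op⊤ op⊥ opDep op⊻ : Op

InFrag : (Op → Set) → Fml → Set
InFrag M ⊤'         = M op⊤
InFrag M ⊥'         = M op⊥
InFrag M (atom p)   = ⊤
InFrag M (natom p)  = M opNeg
InFrag M (dep ps q) = M opDep
InFrag M (ndep ps q) = M opNeg × M opDep
InFrag M (φ ∧' ψ)   = M op∧ × InFrag M φ × InFrag M ψ
InFrag M (φ ∨' ψ)   = M op∨ × InFrag M φ × InFrag M ψ
InFrag M (φ ⊻' ψ)   = M op⊻ × InFrag M φ × InFrag M ψ
InFrag M (□ φ)      = M op□ × InFrag M φ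
InFrag M (◇ φ)      = M op◇ × InFrag M φ

record Frame : Set₁ where
  field
    S : Set
    R : S → S → Set
    π : S → AP → Bool      -- π s p ≡ true  iff  p ∈ π(s)
open Frame public

Lift′ : Set → Set₁
Lift′ A = Lift (suc zero) A

Team : Frame → Set₁
Team W = S W → Set

_⊨[_]_ : (W : Frame) → Team W → Fml → Set₁
W ⊨[ T ] ⊤'         = Lift′ ⊤
W ⊨[ T ] ⊥'         = Lift′ (∀ s → ¬ T s)
W ⊨[ T ] atom p     = Lift′ (∀ s → T s → π W s p ≡ true)
W ⊨[ T ] natom p    = Lift′ (∀ s → T s → π W s p ≡ false)
W ⊨[ T ] dep ps q   = Lift′ (∀ s₁ s₂ → T s₁ → T s₂ →
                        All (λ p → π W s₁ p ≡ π W s₂ p) ps → π W s₁ q ≡ π W s₂ q)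
W ⊨[ T ] ndep ps q  = Lift′ (∀ s → ¬ T s)
W ⊨[ T ] (φ ∧' ψ)   = (W ⊨[ T ] φ) × (W ⊨[ T ] ψ)
W ⊨[ T ] (φ ∨' ψ)   = Σ (Team W) λ T₁ → Σ (Team W) λ T₂ →
                        (∀ s → (T s → T₁ s ⊎ T₂ s) × (T₁ s ⊎ T₂ s → T s))
                        × (W ⊨[ T₁ ] φ) × (W ⊨[ T₂ ] ψ)
W ⊨[ T ] (φ ⊻' ψ)   = (W ⊨[ T ] φ) ⊎ (W ⊨[ T ] ψ)
W ⊨[ T ] (□ φ)      = W ⊨[ (λ s′ → ∃ λ s → T s × R W s s′) ] φ
W ⊨[ T ] (◇ φ)      = Σ (Team W) λ T′ → (W ⊨[ T′ ] φ) ×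
                        Lift′ (∀ s → T s → ∃ λ s′ → T′ s′ × R W s s′)

Satisfiable : Fml → Set₁
Satisfiable φ = Σ Frame λ W → Σ (Team W) λ T → (∃ λ s → T s) × (W ⊨[ T ] φ)

-- replace every atomic proposition and every dependence atom by the atom t
-- (negated atoms / negated dependence atoms become \overline{t}; these do not
--  occur in the negation-free fragments the theorem is about)
replace : AP → Fml → Fml
replace t ⊤'          = ⊤'
replace t ⊥'          = ⊥'
replace t (atom p)    = atom t
replace t (natom p)   = natom t
replace t (dep ps q)  = atom t
replace t (ndep ps q) = natom t
replace t (φ ∧' ψ)    = replace t φ ∧' replace t ψ
replace t (φ ∨' ψ)    = replace t φ ∨' replace t ψ
replace t (φ ⊻' ψ)    = replace t φ ⊻' replace t ψ
replace t (□ φ)       = □ replace t φ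
replace t (◇ φ)       = ◇ replace t φ

module Submission where

-- Without negation, MDL formulas cannot observe that an
-- atomic proposition is false: a proposition p only ever demands truth, and a
-- dependence atom is trivially satisfied when every proposition has the same
-- value everywhere.  Hence, given any frame W, the "saturated" frame that
-- keeps the worlds and accessibility of W but makes every proposition true
-- everywhere satisfies every negation-free formula that W satisfies on a team
-- (`saturate-preserves`).  On a saturated frame, p, dep(ps; q) and t are all
-- satisfied by every team, so a negation-free φ and its replacement
-- replace t φ hold on exactly the same teams (`saturated-replace`).
--
-- The theorem follows: a model of φ (resp. of replace t φ) yields, after
-- saturation, a model of both formulas on the same nonempty team.  The
-- hypothesis opNeg ∉ M enters only through `frag-negFree`: every MDL[M]
-- formula is negation-free, and so is its replacement (`replace-negFree`).

open import Defs
open import Relation.Nullary using (¬_)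
open import Function.Bundles using (_⇔_; mk⇔; Equivalence)
open import Function.Construct.Identity using (↠-id; ⇔-id)
open import Data.Bool using (true)
open import Data.Product using (_×_; _,_)
open import Data.Product.Function.NonDependent.Propositional using (_×-⇔_)
open import Data.Product.Function.Dependent.Propositional using (Σ-⇔)
open import Data.Sum.Function.Propositional using (_⊎-⇔_)
open import Data.Sum using (inj₁; inj₂)
open import Data.Empty using (⊥)
open import Data.Unit using (⊤; tt)
open import Level using (lift)
open import Relation.Binary.PropositionalEquality using (refl)

open Equivalence using (to; from)

NegFree : Fml → Set
NegFree ⊤'          = ⊤
NegFree ⊥'          = ⊤
NegFree (atom p)    = ⊤
NegFree (natom p)   = ⊥
NegFree (dep ps q)  = ⊤
NegFree (ndep ps q) = ⊥
NegFree (φ ∧' ψ)    = NegFree φ × NegFree ψ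
NegFree (φ ∨' ψ)    = NegFree φ × NegFree ψ
NegFree (φ ⊻' ψ)    = NegFree φ × NegFree ψ
NegFree (□ φ)       = NegFree φ
NegFree (◇ φ)       = NegFree φ

frag-negFree : {M : Op → Set} → ¬ M opNeg → (φ : Fml) → InFrag M φ → NegFree φ
frag-negFree noNeg ⊤'          _           = tt
frag-negFree noNeg ⊥'          _           = tt
frag-negFree noNeg (atom p)    _           = tt
frag-negFree noNeg (natom p)   neg         = noNeg neg
frag-negFree noNeg (dep ps q)  _           = tt
frag-negFree noNeg (ndep ps q) (neg , _)   = noNeg neg
frag-negFree noNeg (φ ∧' ψ)    (_ , i , j) = frag-negFree noNeg φ i , frag-negFree noNeg ψ j
frag-negFree noNeg (φ ∨' ψ)    (_ , i , j) = frag-negFree noNeg φ i , frag-negFree noNeg ψ j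
frag-negFree noNeg (φ ⊻' ψ)    (_ , i , j) = frag-negFree noNeg φ i , frag-negFree noNeg ψ j
frag-negFree noNeg (□ φ)       (_ , i)     = frag-negFree noNeg φ i
frag-negFree noNeg (◇ φ)       (_ , i)     = frag-negFree noNeg φ i

replace-negFree : (t : AP) (φ : Fml) → NegFree φ → NegFree (replace t φ)
replace-negFree t ⊤'          _         = tt
replace-negFree t ⊥'          _         = tt
replace-negFree t (atom p)    _         = tt
replace-negFree t (dep ps q)  _         = tt
replace-negFree t (φ ∧' ψ)    (n₁ , n₂) = replace-negFree t φ n₁ , replace-negFree t ψ n₂
replace-negFree t (φ ∨' ψ)    (n₁ , n₂) = replace-negFree t φ n₁ , replace-negFree t ψ n₂
replace-negFree t (φ ⊻' ψ)    (n₁ , n₂) = replace-negFree t φ n₁ , replace-negFree t ψ n₂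
replace-negFree t (□ φ)       n         = replace-negFree t φ n
replace-negFree t (◇ φ)       n         = replace-negFree t φ n

saturate : Frame → Frame
saturate W = record { S = S W ; R = R W ; π = λ _ _ → true }

saturate-preserves : (W : Frame) (φ : Fml) → NegFree φ → (T : Team W) →
                     W ⊨[ T ] φ → saturate W ⊨[ T ] φ
saturate-preserves W ⊤'         _         T h = h
saturate-preserves W ⊥'         _         T h = h
saturate-preserves W (atom p)   _         T _ = lift λ _ _ → refl
saturate-preserves W (dep ps q) _         T _ = lift λ _ _ _ _ _ → refl
saturate-preserves W (φ ∧' ψ)   (n₁ , n₂) T (h₁ , h₂) =
  saturate-preserves W φ n₁ T h₁ , saturate-preserves W ψ n₂ T h₂
saturate-preserves W (φ ∨' ψ)   (n₁ , n₂) T (T₁ , T₂ , cover , h₁ , h₂) =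
  T₁ , T₂ , cover , saturate-preserves W φ n₁ T₁ h₁ , saturate-preserves W ψ n₂ T₂ h₂
saturate-preserves W (φ ⊻' ψ)   (n₁ , n₂) T (inj₁ h) =
  inj₁ (saturate-preserves W φ n₁ T h)
saturate-preserves W (φ ⊻' ψ)   (n₁ , n₂) T (inj₂ h) =
  inj₂ (saturate-preserves W ψ n₂ T h)
saturate-preserves W (□ φ)      n         T h = saturate-preserves W φ n _ h
saturate-preserves W (◇ φ)      n         T (T′ , h , succ) =
  T′ , saturate-preserves W φ n T′ h , succ

-- On a saturated frame a negation-free formula and its replacement agree on
-- every team: atoms, dependence atoms and t are all satisfied by every team.
saturated-replace : (W : Frame) (t : AP) (φ : Fml) → NegFree φ → (T : Team W) →
                    (saturate W ⊨[ T ] φ) ⇔ (saturate W ⊨[ T ] replace t φ)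
saturated-replace W t ⊤'         _         T = mk⇔ (λ h → h) (λ h → h)
saturated-replace W t ⊥'         _         T = mk⇔ (λ h → h) (λ h → h)
saturated-replace W t (atom p)   _         T = mk⇔ (λ _ → lift λ _ _ → refl) (λ _ → lift λ _ _ → refl)
saturated-replace W t (dep ps q) _         T =
  mk⇔ (λ _ → lift λ _ _ → refl) (λ _ → lift λ _ _ _ _ _ → refl)
saturated-replace W t (φ ∧' ψ)   (n₁ , n₂) T =
  saturated-replace W t φ n₁ T ×-⇔ saturated-replace W t ψ n₂ T
saturated-replace W t (φ ∨' ψ)   (n₁ , n₂) T =
  Σ-⇔ (↠-id _) λ {T₁} → Σ-⇔ (↠-id _) λ {T₂} →
    ⇔-id _ ×-⇔ saturated-replace W t φ n₁ T₁ ×-⇔ saturated-replace W t ψ n₂ T₂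
saturated-replace W t (φ ⊻' ψ)   (n₁ , n₂) T =
  saturated-replace W t φ n₁ T ⊎-⇔ saturated-replace W t ψ n₂ T
saturated-replace W t (□ φ)      n         T = saturated-replace W t φ n _
saturated-replace W t (◇ φ)      n         T =
  Σ-⇔ (↠-id _) λ {T′} → saturated-replace W t φ n T′ ×-⇔ ⇔-id _

-- Lemma 2: for ¬ ∉ M, an MDL[M] formula is satisfiable iff its replacement is.
-- Either model, once saturated, satisfies both formulas on the same team.
lemma2 : (M : Op → Set) → ¬ M opNeg → (φ : Fml) → InFrag M φ → (t : AP) →
         Satisfiable φ ⇔ Satisfiable (replace t φ)
lemma2 M noNeg φ inFrag t = mk⇔
  (λ { (W , T , nonempty , h) →
         saturate W , T , nonempty ,
         to (saturated-replace W t φ negFree T) (saturate-preserves W φ negFree T h) })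
  (λ { (W , T , nonempty , h) →
         saturate W , T , nonempty ,
         from (saturated-replace W t φ negFree T)
              (saturate-preserves W (replace t φ) (replace-negFree t φ negFree) T h) })
  where
    negFree : NegFree φ
    negFree = frag-negFree noNeg φ inFrag
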